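{- Let $M$ be a $\lambda$-term. Then for every finite or infinite leftmost-outermost $\beta$-reduction rewrite sequence $\sigma : M = M_0 \to_{lo\beta} M_1 \to_{lo\beta} \cdots \to_{lo\beta} M_k \ (\to_{lo\beta} M_{k+1} \to_{lo\beta} \cdots)$ starting from $M$, of length $l\in\mathbb{N}\cup\{\infty\}$, the following hold: (i) $\mathrm{depth}(M_{n+1}) \le \mathrm{depth}(M_n) + \mathrm{depth}(M)$ for all $n\in\mathbb{N}$ with $n+1\le l$, i.e. the depth increase in each step of $\sigma$ is uniformly bounded by $\mathrm{depth}(M)$; (ii) $\mathrm{depth}(M_n) \le \mathrm{depth}(M) + n\cdot\mathrm{depth}(M) = (n+1)\cdot\mathrm{depth}(M)$ for all $n\in\mathbb{N}$ with $n\le l$; hence $\mathrm{depth}(M_n)-\mathrm{depth}(M)\in O(n)$.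
   Context: $\lambda$-terms are taken modulo $\alpha$-conversion. $\to_{lo\beta}$ denotes leftmost-outermost $\beta$-reduction, i.e. contraction of the leftmost-outermost $\beta$-redex. The depth $\mathrm{depth}(M)$ of a $\lambda$-term is the length of the longest path from the root to a leaf in its syntax tree (a variable has depth $0$, $\mathrm{depth}(\lambda x.N)=1+\mathrm{depth}(N)$, $\mathrm{depth}(N\,P)=1+\max\{\mathrm{depth}(N),\mathrm{depth}(P)\}$). -}

module Defs where

open import Data.Nat using (ℕ; zero; suc; _+_; _*_; _≤_; _⊔_; _∸_; _<ᵇ_; compare; less; equal; greater)
open import Data.Bool using (true; false)
open import Data.Unit using (⊤)
open import Data.Product using (Σ; _×_)
open import Relation.Binary.PropositionalEquality using (_≡_)
open import Relation.Nullary using (¬_)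

-- λ-terms modulo α-conversion, represented with de Bruijn indices.
data Term : Set where
  var : ℕ → Term
  ƛ_  : Term → Term
  _·_ : Term → Term → Term

infixl 7 _·_
infix  6 ƛ_

depth : Term → ℕ
depth (var x) = 0
depth (ƛ N)   = suc (depth N)
depth (N · P) = suc (depth N ⊔ depth P)

shift : ℕ → ℕ → Term → Term
shift d c (var x) with x <ᵇ c
... | true  = var x
... | false = var (x + d)
shift d c (ƛ N)   = ƛ shift d (suc c) N
shift d c (N · P) = shift d c N · shift d c P

-- substitution of P for index j, removing index j (free indices > j are decremented);
-- P is already shifted appropriately for the current binder depth.
subst : ℕ → Term → Term → Term
subst j P (var x) with compare x j
... | less _ _    = var x
... | equal _     = P
... | greater _ k = var (x ∸ 1)
subst j P (ƛ N)   = ƛ subst (suc j) (shift 1 0 P) N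
subst j P (N · Q) = subst j P N · subst j P Q

_[_] : Term → Term → Term
N [ P ] = subst 0 P N

data Neutral : Term → Set
data Normal  : Term → Set

data Neutral where
  ne-var : ∀ {x} → Neutral (var x)
  ne-app : ∀ {M N} → Neutral M → Normal N → Neutral (M · N)

data Normal where
  nf-ne  : ∀ {M} → Neutral M → Normal M
  nf-lam : ∀ {M} → Normal M → Normal (ƛ M)

IsAbs : Term → Set
IsAbs M = Σ Term (λ N → M ≡ (ƛ N))

data _→lo_ : Term → Term → Set where
  lo-β   : ∀ {N P} → ((ƛ N) · P) →lo (N [ P ])
  lo-ƛ   : ∀ {N N'} → N →lo N' → (ƛ N) →lo (ƛ N')
  lo-appL : ∀ {M M' N} → ¬ IsAbs M → M →lo M' → (M · N) →lo (M' · N)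
  lo-appR : ∀ {M N N'} → Neutral M → N →lo N' → (M · N) →lo (M · N')

infix 4 _→lo_

data ℕ∞ : Set where
  fin : ℕ → ℕ∞
  ∞   : ℕ∞

_≤∞_ : ℕ → ℕ∞ → Set
n ≤∞ fin l = n ≤ l
n ≤∞ ∞     = ⊤

IsLoSeq : Term → ℕ∞ → (ℕ → Term) → Set
IsLoSeq M l s = (s 0 ≡ M) × (∀ n → suc n ≤∞ l → s n →lo s (suc n))

module Submission where

-- Call a term d-guarded when every abstraction ƛ N in it binds only
-- occurrences lying at most d levels below the λ node.  Contracting a
-- redex (ƛ N) P of a guarded term copies P only to positions at depth
-- ≤ d, so the contractum is at most d deeper than the redex; moreover
-- guardedness is stable under shifting and substitution, so the
-- contractum N[P] is again d-guarded.  Guardedness itself is not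
-- preserved by reducing under a binder, but a binder that leftmost-
-- outermost reduction has passed is never contracted later.  We
-- therefore use the weaker invariant LoGuarded: every abstraction that
-- the leftmost-outermost strategy may still contract is guarded.  It
-- holds initially with d = depth M (every term is depth-guarded), is
-- preserved by each step, and bounds each step's depth increase by d.
-- Part (ii) of the theorem then follows by summing these increments.

open import Defs
open import Data.Nat using (ℕ; zero; suc; _+_; _*_; _≤_; _<_; _⊔_; _<ᵇ_; compare; less; equal; greater; z≤n; s≤s; z<s)
open import Data.Nat.Properties
open import Data.Product using (_×_; _,_)
open import Data.Bool using (true; false; T)
open import Data.Unit using (tt; ⊤)
open import Data.Empty using (⊥; ⊥-elim)
open import Relation.Nullary using (¬_)
open import Relation.Binary.PropositionalEquality using (_≡_; _≢_; refl; sym; trans; cong)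
  renaming (subst to transport)

<ᵇ-true : ∀ {x c} → (x <ᵇ c) ≡ true → x < c
<ᵇ-true {x} {c} eq = <ᵇ⇒< x c (transport T (sym eq) tt)

<ᵇ-false : ∀ {x c} → (x <ᵇ c) ≡ false → c ≤ x
<ᵇ-false {x} {c} eq = ≮⇒≥ (λ x<c → transport T eq (<⇒<ᵇ x<c))

offset-depth-app : ∀ c N P → c + depth (N · P) ≡ (suc c + depth N) ⊔ (suc c + depth P)
offset-depth-app c N P = trans (+-suc c (depth N ⊔ depth P)) (cong suc (+-distribˡ-⊔ c (depth N) (depth P)))

⊔-bound : ∀ {x y x₀ y₀} h → x ≤ x₀ ⊔ h → y ≤ y₀ ⊔ h → x ⊔ y ≤ (x₀ ⊔ y₀) ⊔ h
⊔-bound {x₀ = x₀} {y₀} h p q =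
  ⊔-lub (≤-trans p (⊔-monoˡ-≤ h (m≤m⊔n x₀ y₀))) (≤-trans q (⊔-monoˡ-≤ h (m≤n⊔m x₀ y₀)))

⊔-growth : ∀ {a b a' b'} d → a' ≤ a + d → b' ≤ b + d → a' ⊔ b' ≤ (a ⊔ b) + d
⊔-growth {a} {b} {a'} {b'} d p q = transport (a' ⊔ b' ≤_) (sym (+-distribʳ-⊔ d a b)) (⊔-mono-≤ p q)

-- Shifting renames variables only, so it keeps the shape of the tree.
depth-shift : ∀ δ c t → depth (shift δ c t) ≡ depth t
depth-shift δ c (var x) with x <ᵇ c
... | true  = refl
... | false = refl
depth-shift δ c (ƛ t)   = cong suc (depth-shift δ (suc c) t)
depth-shift δ c (t · u) rewrite depth-shift δ c t | depth-shift δ c u = refl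

-- Substituted terms are fresh for the indices they are
-- shifted over, which keeps substitution from creating new bound
-- occurrences.
Fresh : ℕ → Term → Set
Fresh k (var x) = x ≢ k
Fresh k (ƛ t)   = Fresh (suc k) t
Fresh k (t · u) = Fresh k t × Fresh k u

shift-fresh-cutoff : ∀ δ c t → Fresh c (shift (suc δ) c t)
shift-fresh-cutoff δ c (var x) with x <ᵇ c in eq
... | true  = <⇒≢ (<ᵇ-true eq)
... | false = λ x+δ≡c → <⇒≱ (transport (x <_) x+δ≡c (m<m+n x z<s)) (<ᵇ-false eq)
shift-fresh-cutoff δ c (ƛ t)   = shift-fresh-cutoff δ (suc c) t
shift-fresh-cutoff δ c (t · u) = shift-fresh-cutoff δ c t , shift-fresh-cutoff δ c u

shift-fresh : ∀ δ k c t → c ≤ k → Fresh k t → Fresh (δ + k) (shift δ c t)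
shift-fresh δ k c (var x) c≤k fresh with x <ᵇ c in eq
... | true  = λ x≡δ+k → <⇒≱ (<ᵇ-true eq) (≤-trans c≤k (transport (k ≤_) (sym x≡δ+k) (m≤n+m k δ)))
... | false = λ x+δ≡δ+k → fresh (+-cancelʳ-≡ δ x k (trans x+δ≡δ+k (+-comm δ k)))
shift-fresh δ k c (ƛ t) c≤k fresh =
  transport (λ i → Fresh i (shift δ (suc c) t)) (+-suc δ k) (shift-fresh δ (suc k) (suc c) t (s≤s c≤k) fresh)
shift-fresh δ k c (t · u) c≤k (ft , fu) = shift-fresh δ k c t c≤k ft , shift-fresh δ k c u c≤k fu

-- OccDepth j c h t: every occurrence of index j in t lies at depth ≤ h,
-- when the root of t sits at depth c.
OccDepth : ℕ → ℕ → ℕ → Term → Set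
OccDepth j c h (var x) = x ≡ j → c ≤ h
OccDepth j c h (ƛ t)   = OccDepth (suc j) (suc c) h t
OccDepth j c h (t · u) = OccDepth j (suc c) h t × OccDepth j (suc c) h u

Guarded : ℕ → Term → Set
Guarded d (var x) = ⊤
Guarded d (ƛ t)   = OccDepth 0 1 d t × Guarded d t
Guarded d (t · u) = Guarded d t × Guarded d u

fresh⇒occDepth : ∀ {k c h} t → Fresh k t → OccDepth k c h t
fresh⇒occDepth (var x) fresh x≡k = ⊥-elim (fresh x≡k)
fresh⇒occDepth (ƛ t)   fresh     = fresh⇒occDepth t fresh
fresh⇒occDepth (t · u) (ft , fu) = fresh⇒occDepth t ft , fresh⇒occDepth u fu

shift-occDepth : ∀ δ k c' h c t → k < c → OccDepth k c' h t → OccDepth k c' h (shift δ c t)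
shift-occDepth δ k c' h c (var x) k<c occ with x <ᵇ c in eq
... | true  = occ
... | false = λ x+δ≡k → ⊥-elim (<⇒≱ k<c (≤-trans (<ᵇ-false eq) (transport (x ≤_) x+δ≡k (m≤m+n x δ))))
shift-occDepth δ k c' h c (ƛ t) k<c occ = shift-occDepth δ (suc k) (suc c') h (suc c) t (s≤s k<c) occ
shift-occDepth δ k c' h c (t · u) k<c (ot , ou) =
  shift-occDepth δ k (suc c') h c t k<c ot , shift-occDepth δ k (suc c') h c u k<c ou

shift-guarded : ∀ δ d c t → Guarded d t → Guarded d (shift δ c t)
shift-guarded δ d c (var x) g with x <ᵇ c
... | true  = tt
... | false = tt
shift-guarded δ d c (ƛ t) (occ , g) = shift-occDepth δ 0 1 d (suc c) t z<s occ , shift-guarded δ d (suc c) t g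
shift-guarded δ d c (t · u) (gt , gu) = shift-guarded δ d c t gt , shift-guarded δ d c u gu

subst-occDepth : ∀ k j c h P t → k < j → Fresh k P → OccDepth k c h t → OccDepth k c h (subst j P t)
subst-occDepth k j c h P (var x) k<j fresh occ with compare x j
... | less _ _    = occ
... | equal _     = fresh⇒occDepth P fresh
... | greater _ m = λ j+m≡k → ⊥-elim (<⇒≱ k<j (transport (j ≤_) j+m≡k (m≤m+n j m)))
subst-occDepth k j c h P (ƛ t) k<j fresh occ =
  subst-occDepth (suc k) (suc j) (suc c) h (shift 1 0 P) t (s≤s k<j) (shift-fresh 1 k 0 P z≤n fresh) occ
subst-occDepth k j c h P (t · u) k<j fresh (ot , ou) =
  subst-occDepth k j (suc c) h P t k<j fresh ot , subst-occDepth k j (suc c) h P u k<j fresh ou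

-- Substitution of a guarded term, fresh for all indices below j (as
-- produced by shifting it over j binders), preserves guardedness.
subst-guarded : ∀ d j P t → (∀ k → k < j → Fresh k P) → Guarded d P → Guarded d t → Guarded d (subst j P t)
subst-guarded d j P (var x) _ gP _ with compare x j
... | less _ _    = tt
... | equal _     = gP
... | greater _ _ = tt
subst-guarded d j P (ƛ t) freshP gP (occ , g) =
  subst-occDepth 0 (suc j) 1 d (shift 1 0 P) t z<s (shift-fresh-cutoff 0 0 P) occ ,
  subst-guarded d (suc j) (shift 1 0 P) t freshP' (shift-guarded 1 d 0 P gP) g
  where
  freshP' : ∀ k → k < suc j → Fresh k (shift 1 0 P)
  freshP' zero    _         = shift-fresh-cutoff 0 0 P
  freshP' (suc k) (s≤s k<j) = shift-fresh 1 k 0 P z≤n (freshP k k<j)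
subst-guarded d j P (t · u) freshP gP (gt , gu) =
  subst-guarded d j P t freshP gP gt , subst-guarded d j P u freshP gP gu

depth-subst : ∀ j c h P t → OccDepth j c h t → c + depth (subst j P t) ≤ (c + depth t) ⊔ (h + depth P)
depth-subst j c h P (var x) occ with compare x j
... | less _ _    = m≤m⊔n _ _
... | equal _     = ≤-trans (+-monoˡ-≤ (depth P) (occ refl)) (m≤n⊔m _ _)
... | greater _ _ = m≤m⊔n _ _
depth-subst j c h P (ƛ t) occ
  rewrite +-suc c (depth (subst (suc j) (shift 1 0 P) t)) | +-suc c (depth t) =
  transport (λ e → suc c + depth (subst (suc j) (shift 1 0 P) t) ≤ (suc c + depth t) ⊔ (h + e))
    (depth-shift 1 0 P) (depth-subst (suc j) (suc c) h (shift 1 0 P) t occ)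
depth-subst j c h P (t · u) (ot , ou)
  rewrite offset-depth-app c (subst j P t) (subst j P u) | offset-depth-app c t u =
  ⊔-bound (h + depth P) (depth-subst j (suc c) h P t ot) (depth-subst j (suc c) h P u ou)

depth⇒occDepth : ∀ j c h t → c + depth t ≤ h → OccDepth j c h t
depth⇒occDepth j c h (var x) le _ = transport (_≤ h) (+-identityʳ c) le
depth⇒occDepth j c h (ƛ t) le = depth⇒occDepth (suc j) (suc c) h t (transport (_≤ h) (+-suc c (depth t)) le)
depth⇒occDepth j c h (t · u) le =
  depth⇒occDepth j (suc c) h t (m⊔n≤o⇒m≤o (suc c + depth t) (suc c + depth u) le') ,
  depth⇒occDepth j (suc c) h u (m⊔n≤o⇒n≤o (suc c + depth t) (suc c + depth u) le')
  where
  le' : (suc c + depth t) ⊔ (suc c + depth u) ≤ h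
  le' = transport (_≤ h) (offset-depth-app c t u) le

depth⇒guarded : ∀ d t → depth t ≤ d → Guarded d t
depth⇒guarded d (var x) _  = tt
depth⇒guarded d (ƛ t)   le = depth⇒occDepth 0 1 d t le , depth⇒guarded d t (≤-trans (n≤1+n _) le)
depth⇒guarded d (t · u) le =
  depth⇒guarded d t (≤-trans (≤-trans (m≤m⊔n _ _) (n≤1+n _)) le) ,
  depth⇒guarded d u (≤-trans (≤-trans (m≤n⊔m _ _) (n≤1+n _)) le)

depth-contract : ∀ d N P → OccDepth 0 1 d N → depth (N [ P ]) ≤ depth ((ƛ N) · P) + d
depth-contract d N P occ = begin
  depth (N [ P ])                       ≤⟨ n≤1+n _ ⟩
  suc (depth (N [ P ]))                 ≤⟨ depth-subst 0 1 d P N occ ⟩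
  suc (depth N) ⊔ (d + depth P)         ≤⟨ ⊔-mono-≤ (m≤m+n _ d) (≤-reflexive (+-comm d (depth P))) ⟩
  (suc (depth N) + d) ⊔ (depth P + d)   ≡⟨ sym (+-distribʳ-⊔ d (suc (depth N)) (depth P)) ⟩
  (suc (depth N) ⊔ depth P) + d         ≤⟨ +-monoˡ-≤ d (n≤1+n _) ⟩
  depth ((ƛ N) · P) + d                 ∎
  where open ≤-Reasoning

neutral-irreducible : ∀ {M M'} → Neutral M → M →lo M' → ⊥
normal-irreducible  : ∀ {M M'} → Normal M → M →lo M' → ⊥
neutral-irreducible ne-var ()
neutral-irreducible (ne-app () _) lo-β
neutral-irreducible (ne-app m _) (lo-appL _ st) = neutral-irreducible m st
neutral-irreducible (ne-app _ n) (lo-appR _ st) = normal-irreducible n st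
normal-irreducible (nf-ne m)  st         = neutral-irreducible m st
normal-irreducible (nf-lam n) (lo-ƛ st)  = normal-irreducible n st

-- LoGuarded d t: every abstraction that leftmost-outermost reduction of t
-- may still contract is d-guarded.  Below a λ, and to the right of a
-- neutral head, only the part still to be reduced is constrained.
data LoGuarded (d : ℕ) : Term → Set where
  lg-var   : ∀ {x} → LoGuarded d (var x)
  lg-ƛ     : ∀ {N} → LoGuarded d N → LoGuarded d (ƛ N)
  lg-redex : ∀ {N P} → Guarded d (ƛ N) → Guarded d P → LoGuarded d ((ƛ N) · P)
  lg-appL  : ∀ {M N} → ¬ IsAbs M → LoGuarded d M → Guarded d N → LoGuarded d (M · N)
  lg-appR  : ∀ {M N} → Neutral M → LoGuarded d N → LoGuarded d (M · N)

not-abs-app : ∀ {M N} → ¬ IsAbs (M · N)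
not-abs-app (_ , ())

not-abs-var : ∀ {x} → ¬ IsAbs (var x)
not-abs-var (_ , ())

guarded⇒loGuarded : ∀ d t → Guarded d t → LoGuarded d t
guarded⇒loGuarded d (var x)       _        = lg-var
guarded⇒loGuarded d (ƛ t)         (_ , g)  = lg-ƛ (guarded⇒loGuarded d t g)
guarded⇒loGuarded d (var x · u)   (_ , gu) = lg-appL not-abs-var lg-var gu
guarded⇒loGuarded d ((ƛ t) · u)   (gt , gu) = lg-redex gt gu
guarded⇒loGuarded d (t · t' · u)  (gt , gu) = lg-appL not-abs-app (guarded⇒loGuarded d (t · t') gt) gu

loGuarded-app : ∀ d M N → (IsAbs M → Guarded d M) → LoGuarded d M → Guarded d N → LoGuarded d (M · N)
loGuarded-app d (var x) N _     lgM gN = lg-appL not-abs-var lgM gN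
loGuarded-app d (ƛ K)   N absGd _   gN = lg-redex (absGd (K , refl)) gN
loGuarded-app d (t · u) N _     lgM gN = lg-appL not-abs-app lgM gN

contract-guarded : ∀ d N P → Guarded d (ƛ N) → Guarded d P → Guarded d (N [ P ])
contract-guarded d N P (_ , gN) gP = subst-guarded d 0 P N (λ _ ()) gP gN

-- A step from a non-abstraction produces an abstraction only by
-- contracting a root redex; the result is then guarded.
new-abs-guarded : ∀ {d t t'} → LoGuarded d t → t →lo t' → ¬ IsAbs t → IsAbs t' → Guarded d t'
new-abs-guarded (lg-redex {N} {P} gλ gP) lo-β _ _ = contract-guarded _ N P gλ gP
new-abs-guarded (lg-appL notAbs _ _) lo-β _ _ = ⊥-elim (notAbs (_ , refl))
new-abs-guarded (lg-appR () _) lo-β _ _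
new-abs-guarded _ (lo-ƛ _)       notAbs _ = ⊥-elim (notAbs (_ , refl))
new-abs-guarded _ (lo-appL _ _)  _      isAbs = ⊥-elim (not-abs-app isAbs)
new-abs-guarded _ (lo-appR _ _)  _      isAbs = ⊥-elim (not-abs-app isAbs)

loGuarded-step : ∀ {d t t'} → LoGuarded d t → t →lo t' → LoGuarded d t'
loGuarded-step (lg-redex {N} {P} gλ gP) lo-β = guarded⇒loGuarded _ (N [ P ]) (contract-guarded _ N P gλ gP)
loGuarded-step (lg-appL notAbs _ _) lo-β = ⊥-elim (notAbs (_ , refl))
loGuarded-step (lg-appR () _) lo-β
loGuarded-step (lg-ƛ lg) (lo-ƛ st) = lg-ƛ (loGuarded-step lg st)
loGuarded-step (lg-redex _ _) (lo-appL notAbs _) = ⊥-elim (notAbs (_ , refl))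
loGuarded-step {d} {M · N} {M' · .N} (lg-appL _ lgM gN) (lo-appL notAbs st) =
  loGuarded-app d M' N (new-abs-guarded lgM st notAbs) (loGuarded-step lgM st) gN
loGuarded-step (lg-appR ne _) (lo-appL _ st) = ⊥-elim (neutral-irreducible ne st)
loGuarded-step (lg-redex _ _) (lo-appR () _)
loGuarded-step {d} {M · N} (lg-appL _ _ gN) (lo-appR ne st) =
  lg-appR ne (loGuarded-step (guarded⇒loGuarded d N gN) st)
loGuarded-step (lg-appR _ lgN) (lo-appR ne st) = lg-appR ne (loGuarded-step lgN st)

depth-step : ∀ {d t t'} → LoGuarded d t → t →lo t' → depth t' ≤ depth t + d
depth-step {d} (lg-redex {N} {P} (occ , _) _) lo-β = depth-contract d N P occ
depth-step (lg-appL notAbs _ _) lo-β = ⊥-elim (notAbs (_ , refl))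
depth-step (lg-appR () _) lo-β
depth-step (lg-ƛ lg) (lo-ƛ st) = s≤s (depth-step lg st)
depth-step (lg-redex _ _) (lo-appL notAbs _) = ⊥-elim (notAbs (_ , refl))
depth-step {d} (lg-appL _ lgM _) (lo-appL _ st) = s≤s (⊔-growth d (depth-step lgM st) (m≤m+n _ d))
depth-step (lg-appR ne _) (lo-appL _ st) = ⊥-elim (neutral-irreducible ne st)
depth-step (lg-redex _ _) (lo-appR () _)
depth-step {d} {M · N} (lg-appL _ _ gN) (lo-appR _ st) =
  s≤s (⊔-growth d (m≤m+n _ d) (depth-step (guarded⇒loGuarded d N gN) st))
depth-step {d} (lg-appR _ lgN) (lo-appR _ st) = s≤s (⊔-growth d (m≤m+n _ d) (depth-step lgN st))

≤∞-pred : ∀ n l → suc n ≤∞ l → n ≤∞ l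
≤∞-pred n (fin l) le = ≤-trans (n≤1+n n) le
≤∞-pred n ∞       _  = tt

linear-growth : ∀ (f : ℕ → ℕ) (l : ℕ∞) a d → f 0 ≤ a →
  (∀ n → suc n ≤∞ l → f (suc n) ≤ f n + d) → ∀ n → n ≤∞ l → f n ≤ a + n * d
linear-growth f l a d f0≤a _ zero _ = transport (f 0 ≤_) (sym (+-identityʳ a)) f0≤a
linear-growth f l a d f0≤a growth (suc n) le = begin
  f (suc n)       ≤⟨ growth n le ⟩
  f n + d         ≤⟨ +-monoˡ-≤ d (linear-growth f l a d f0≤a growth n (≤∞-pred n l le)) ⟩
  a + n * d + d   ≡⟨ +-assoc a (n * d) d ⟩
  a + (n * d + d) ≡⟨ cong (a +_) (+-comm (n * d) d) ⟩
  a + suc n * d   ∎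
  where open ≤-Reasoning

theorem3p11 : (M : Term) (l : ℕ∞) (s : ℕ → Term) → IsLoSeq M l s →
    ((n : ℕ) → suc n ≤∞ l → depth (s (suc n)) ≤ depth (s n) + depth M)
    × ((n : ℕ) → n ≤∞ l → depth (s n) ≤ depth M + n * depth M)
theorem3p11 M l s (s0≡M , steps) = stepBound , linear-growth (λ n → depth (s n)) l d d start stepBound
  where
  d : ℕ
  d = depth M

  start : depth (s 0) ≤ d
  start = ≤-reflexive (cong depth s0≡M)

  invariant : ∀ n → n ≤∞ l → LoGuarded d (s n)
  invariant zero    _  = guarded⇒loGuarded d (s 0) (depth⇒guarded d (s 0) start)
  invariant (suc n) le = loGuarded-step (invariant n (≤∞-pred n l le)) (steps n le)

  stepBound : ∀ n → suc n ≤∞ l → depth (s (suc n)) ≤ depth (s n) + d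
  stepBound n le = depth-step (invariant n (≤∞-pred n l le)) (steps n le)
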